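{- Let $G$ be a countably infinite MB-homogeneous graph that is neither complete nor null (edgeless). Then $G$ is either connected or isomorphic to $I_\omega[K_\omega]$. Moreover, if $G$ is not null, then every vertex of $G$ has infinite degree and infinite co-degree.
   Context: Graphs are simple. A homomorphism maps edges to edges; a monomorphism is an injective homomorphism; an endomorphism of $G$ is a homomorphism $G\to G$. $G$ is MB-homogeneous if every monomorphism between finite induced subgraphs of $G$ extends to a bijective endomorphism of $G$. $I_\omega[K_\omega]$ is the disjoint union of countably infinitely many copies of the countably infinite complete graph $K_\omega$, with no edges between different copies. The degree of $v$ is the number of its neighbours; its co-degree is $|\{w\in G: w\neq v,\ w\not\sim v\}|$. -}

module Defs where

open import Level using (0ℓ)
open import Data.Nat using (ℕ)
open import Data.Product using (Σ; _×_; _,_)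
open import Data.List using (List)
open import Data.List.Membership.Propositional using (_∈_)
open import Relation.Binary.PropositionalEquality using (_≡_; _≢_)
open import Relation.Nullary using (¬_)
open import Function.Definitions using (Bijective)

record Graph (V : Set) : Set₁ where
  field
    _∼_    : V → V → Set
    ∼-sym  : ∀ {x y} → x ∼ y → y ∼ x
    ∼-irr  : ∀ {x} → ¬ (x ∼ x)
open Graph public

-- Countably infinite graphs are represented with vertex set ℕ.

IsHom : {V : Set} → Graph V → (V → V) → Set
IsHom G f = ∀ x y → _∼_ G x y → _∼_ G (f x) (f y)

-- MB-homogeneity: every monomorphism between finite induced subgraphs
-- (domain a finite vertex set A, given as a list; the map f is only
-- relevant on A) extends to a bijective endomorphism.
MBHomogeneous : Graph ℕ → Set
MBHomogeneous G =
  (A : List ℕ) (f : ℕ → ℕ) →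
  (∀ x y → x ∈ A → y ∈ A → f x ≡ f y → x ≡ y) →
  (∀ x y → x ∈ A → y ∈ A → _∼_ G x y → _∼_ G (f x) (f y)) →
  Σ (ℕ → ℕ) λ g → Bijective _≡_ _≡_ g × IsHom G g × (∀ x → x ∈ A → g x ≡ f x)

Complete : {V : Set} → Graph V → Set
Complete G = ∀ x y → x ≢ y → _∼_ G x y

Null : {V : Set} → Graph V → Set
Null G = ∀ x y → ¬ (_∼_ G x y)

data Reach {V : Set} (G : Graph V) : V → V → Set where
  here : ∀ {x} → Reach G x x
  step : ∀ {x y z} → _∼_ G x y → Reach G y z → Reach G x z

Connected : {V : Set} → Graph V → Set
Connected G = ∀ x y → Reach G x y

_≅_ : {V W : Set} → Graph V → Graph W → Set
_≅_ {V} {W} G H = Σ (V → W) λ φ → Bijective _≡_ _≡_ φ ×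
  (∀ x y → (_∼_ G x y → _∼_ H (φ x) (φ y)) × (_∼_ H (φ x) (φ y) → _∼_ G x y))

-- I_ω[K_ω]: vertices (i , a) = vertex a of the i-th copy of K_ω.
IωKω : Graph (ℕ × ℕ)
IωKω = record
  { _∼_   = λ { (i , a) (j , b) → (i ≡ j) × (a ≢ b) }
  ; ∼-sym = λ { (p , q) → sym' p , λ e → q (sym' e) }
  ; ∼-irr = λ { (_ , q) → q refl' }
  }
  where
  open import Relation.Binary.PropositionalEquality using () renaming (sym to sym'; refl to refl')

Finite : (ℕ → Set) → Set
Finite P = Σ (List ℕ) λ l → ∀ x → P x → x ∈ l

Infinite : (ℕ → Set) → Set
Infinite P = ¬ Finite P

Neighbours : Graph ℕ → ℕ → ℕ → Set
Neighbours G v w = _∼_ G v w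

NonNeighbours : Graph ℕ → ℕ → ℕ → Set
NonNeighbours G v w = (w ≢ v) × ¬ (_∼_ G v w)

module Submission where

-- An MB-homogeneous graph is vertex-transitive, and a non-edge xy can be sent
-- onto any pair of distinct vertices, in particular onto an edge ab. Composing
-- such maps gives an injective self-map of the neighbourhood of a that misses b;
-- the orbit of b is then an infinite sequence of distinct neighbours. Inverses of
-- bijective endomorphisms reflect non-adjacency, which gives the dual argument
-- for non-neighbours. If G is disconnected, sending a non-edge inside a component
-- onto a pair in different components contradicts preservation of reachability,
-- so components are cliques; they are infinite, and there are infinitely many of
-- them, since otherwise their least vertices could be mapped into one component.
-- Numbering the components and the vertices within each one by rank gives the
-- isomorphism with I_ω[K_ω].

open import Defs
open import Level using (0ℓ)
open import Axiom.ExcludedMiddle using (ExcludedMiddle)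
open import Axiom.DoubleNegationElimination using (em⇒dne)
open import Data.Nat using (ℕ; zero; suc; _≤_; _<_; _≤′_; ≤′-refl; ≤′-step; z≤n; s≤s; _≟_)
open import Data.Nat.Properties
open import Data.Nat.GeneralisedArithmetic using (fold)
open import Data.Fin using (Fin; toℕ)
open import Data.Fin.Properties using (pigeonhole)
open import Data.Product using (Σ; ∃; ∃₂; _×_; _,_; proj₁; proj₂)
open import Data.Sum using (_⊎_; inj₁; inj₂)
open import Data.List using (List; []; _∷_; lookup; length; upTo)
open import Data.List.Membership.Propositional using (_∈_)
open import Data.List.Membership.Propositional.Properties using (∈-upTo⁺)
open import Data.List.Relation.Unary.Any using (here; there; index)
open import Data.List.Relation.Unary.Any.Properties using (lookup-index)
open import Relation.Binary.PropositionalEquality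
open import Relation.Binary.Definitions using (tri<; tri≈; tri>)
open import Relation.Nullary using (¬_; yes; no; contradiction)
open import Relation.Unary using (Pred; _≐_)
open import Function.Definitions using (Bijective; Injective; Surjective)

record DistinctSequence (P : Pred ℕ 0ℓ) : Set where
  constructor distinctSequence
  field
    term : ℕ → ℕ
    injective : Injective _≡_ _≡_ term
    member : ∀ i → P (term i)

distinctSequence⇒infinite : ∀ {P} → DistinctSequence P → Infinite P
distinctSequence⇒infinite {P} (distinctSequence h h-inj Ph) (l , cover) =
  let i , j , i<j , same-slot = pigeonhole (n<1+n (length l)) slot
  in <-irrefl (h-inj (trans (lookup-slot i) (trans (cong (lookup l) same-slot) (sym (lookup-slot j))))) i<j
  where
  slot : Fin (suc (length l)) → Fin (length l)
  slot i = index (cover (h (toℕ i)) (Ph (toℕ i)))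
  lookup-slot : ∀ i → h (toℕ i) ≡ lookup l (slot i)
  lookup-slot i = lookup-index (cover (h (toℕ i)) (Ph (toℕ i)))

distinctSequence-map : ∀ {P Q} {f : ℕ → ℕ} → Injective _≡_ _≡_ f → (∀ {x} → P x → Q (f x)) →
                       DistinctSequence P → DistinctSequence Q
distinctSequence-map {f = f} f-inj f-maps (distinctSequence h h-inj Ph) =
  distinctSequence (λ i → f (h i)) (λ e → h-inj (f-inj e)) (λ i → f-maps (Ph i))

orbit-distinctSequence : ∀ {P} {f : ℕ → ℕ} {s} → Injective _≡_ _≡_ f → (∀ {x} → P x → P (f x)) →
                         P s → (∀ {t} → P t → f t ≢ s) → DistinctSequence P
orbit-distinctSequence {P} {f} {s} f-inj f-maps Ps s∉image = distinctSequence orbit orbit-injective orbit-P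
  where
  orbit : ℕ → ℕ
  orbit = fold s f
  orbit-P : ∀ i → P (orbit i)
  orbit-P zero = Ps
  orbit-P (suc i) = f-maps (orbit-P i)
  orbit-injective : Injective _≡_ _≡_ orbit
  orbit-injective {zero} {zero} _ = refl
  orbit-injective {zero} {suc j} e = contradiction (sym e) (s∉image (orbit-P j))
  orbit-injective {suc i} {zero} e = contradiction e (s∉image (orbit-P i))
  orbit-injective {suc i} {suc j} e = cong suc (orbit-injective (f-inj e))

module Rank (em : ExcludedMiddle 0ℓ) where

  rank : Pred ℕ 0ℓ → ℕ → ℕ
  rank P zero = zero
  rank P (suc n) with em {P n}
  ... | yes _ = suc (rank P n)
  ... | no _ = rank P n

  module _ {P : Pred ℕ 0ℓ} where

    rank-suc : ∀ {n} → P n → rank P (suc n) ≡ suc (rank P n)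
    rank-suc {n} Pn with em {P n}
    ... | yes _ = refl
    ... | no ¬Pn = contradiction Pn ¬Pn

    rank-step : ∀ n → rank P n ≤ rank P (suc n)
    rank-step n with em {P n}
    ... | yes _ = n≤1+n _
    ... | no _ = ≤-refl

    rank-mono′ : ∀ {m n} → m ≤′ n → rank P m ≤ rank P n
    rank-mono′ ≤′-refl = ≤-refl
    rank-mono′ (≤′-step {n} m≤′n) = ≤-trans (rank-mono′ m≤′n) (rank-step n)

    rank-strict : ∀ {x y} → P x → x < y → rank P x < rank P y
    rank-strict Px x<y = subst (_≤ _) (rank-suc Px) (rank-mono′ (≤⇒≤′ x<y))

    rank-injective : ∀ {x y} → P x → P y → rank P x ≡ rank P y → x ≡ y
    rank-injective {x} {y} Px Py e with <-cmp x y
    ... | tri< x<y _ _ = contradiction e (<⇒≢ (rank-strict Px x<y))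
    ... | tri≈ _ x≡y _ = x≡y
    ... | tri> _ _ y<x = contradiction e (≢-sym (<⇒≢ (rank-strict Py y<x)))

    rank-hit : ∀ n {k} → k < rank P n → ∃ λ x → P x × rank P x ≡ k
    rank-hit (suc n) k<rank with em {P n}
    ... | no _ = rank-hit n k<rank
    ... | yes Pn with m≤n⇒m<n∨m≡n (≤-pred k<rank)
    ...   | inj₁ k<rank′ = rank-hit n k<rank′
    ...   | inj₂ refl = n , Pn , refl

    rank-unbounded : Infinite P → ∀ k → ∃ λ n → k ≤ rank P n
    rank-unbounded inf zero = zero , z≤n
    rank-unbounded inf (suc k) =
      let n , k≤rank = rank-unbounded inf k
          x , n≤x , Px = element-above n
      in suc x , ≤-trans (s≤s (≤-trans k≤rank (rank-mono′ (≤⇒≤′ n≤x)))) (rank-strict Px ≤-refl)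
      where
      element-above : ∀ n → ∃ λ x → n ≤ x × P x
      element-above n = em⇒dne em λ ¬above →
        inf (upTo n , λ x Px → ∈-upTo⁺ (≰⇒> λ n≤x → ¬above (x , n≤x , Px)))

    rank-surjective : Infinite P → ∀ k → ∃ λ x → P x × rank P x ≡ k
    rank-surjective inf k = let n , k<rank = rank-unbounded inf (suc k) in rank-hit n k<rank

    infinite⇒distinctSequence : Infinite P → DistinctSequence P
    infinite⇒distinctSequence inf =
      distinctSequence term term-injective (λ k → proj₁ (proj₂ (rank-surjective inf k)))
      where
      term : ℕ → ℕ
      term k = proj₁ (rank-surjective inf k)
      rank-term : ∀ k → rank P (term k) ≡ k
      rank-term k = proj₂ (proj₂ (rank-surjective inf k))
      term-injective : ∀ {j k} → term j ≡ term k → j ≡ k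
      term-injective {j} {k} e = trans (sym (rank-term j)) (trans (cong (rank P) e) (rank-term k))

    least : ∀ {x} → P x → ∃ λ y → P y × rank P y ≡ 0
    least {x} Px = rank-hit (suc x) (≤-trans (s≤s z≤n) (rank-strict Px ≤-refl))

  rank-cong : ∀ {P Q} → P ≐ Q → ∀ n → rank P n ≡ rank Q n
  rank-cong P≐Q zero = refl
  rank-cong {P} {Q} P≐Q@(P⊆Q , Q⊆P) (suc n) with em {P n} | em {Q n}
  ... | yes _ | yes _ = cong suc (rank-cong P≐Q n)
  ... | yes Pn | no ¬Qn = contradiction (P⊆Q Pn) ¬Qn
  ... | no ¬Pn | yes Qn = contradiction (Q⊆P Qn) ¬Pn
  ... | no _ | no _ = rank-cong P≐Q n

module _ {G : Graph ℕ} where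

  Reach-trans : ∀ {x y z} → Reach G x y → Reach G y z → Reach G x z
  Reach-trans here q = q
  Reach-trans (step e p) q = step e (Reach-trans p q)

  Reach-sym : ∀ {x y} → Reach G x y → Reach G y x
  Reach-sym here = here
  Reach-sym (step e p) = Reach-trans (Reach-sym p) (step (∼-sym G e) here)

  Reach-map : ∀ {g} → IsHom G g → ∀ {x y} → Reach G x y → Reach G (g x) (g y)
  Reach-map hom here = here
  Reach-map hom (step e p) = step (hom _ _ e) (Reach-map hom p)

adjacent⇒≢ : (G : Graph ℕ) → ∀ {x y} → _∼_ G x y → x ≢ y
adjacent⇒≢ G x~y refl = ∼-irr G x~y

record BijectiveEndo (G : Graph ℕ) : Set where
  field
    to : ℕ → ℕ
    bijective : Bijective _≡_ _≡_ to
    homomorphism : IsHom G to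

  injective : Injective _≡_ _≡_ to
  injective = proj₁ bijective

  inverse : ℕ → ℕ
  inverse t = proj₁ (proj₂ bijective t)

  to-inverse : ∀ t → to (inverse t) ≡ t
  to-inverse t = proj₂ (proj₂ bijective t) refl

  inverse-injective : Injective _≡_ _≡_ inverse
  inverse-injective {s} {t} e = trans (sym (to-inverse s)) (trans (cong to e) (to-inverse t))

  Neighbours-map : ∀ {z z′ t} → to z ≡ z′ → Neighbours G z t → Neighbours G z′ (to t)
  Neighbours-map refl z~t = homomorphism _ _ z~t

  NonNeighbours-inverse : ∀ {z z′ t} → to z ≡ z′ → NonNeighbours G z′ t → NonNeighbours G z (inverse t)
  NonNeighbours-inverse {z} {t = t} refl (t≢z′ , z′≁t) =
    (λ t′≡z → t≢z′ (trans (sym (to-inverse t)) (cong to t′≡z))) ,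
    (λ z~t′ → z′≁t (subst (_∼_ G (to z)) (to-inverse t) (homomorphism _ _ z~t′)))

open BijectiveEndo

module MBHomogeneousGraph {G : Graph ℕ} (mb : MBHomogeneous G) where

  private
    _~_ : ℕ → ℕ → Set
    _~_ = _∼_ G

  extend : (A : List ℕ) (f : ℕ → ℕ) →
           (∀ x y → x ∈ A → y ∈ A → f x ≡ f y → x ≡ y) →
           (∀ x y → x ∈ A → y ∈ A → x ~ y → f x ~ f y) →
           Σ (BijectiveEndo G) λ g → ∀ x → x ∈ A → to g x ≡ f x
  extend A f f-inj f-hom =
    let g , g-bij , g-hom , g-extends = mb A f f-inj f-hom
    in record { to = g ; bijective = g-bij ; homomorphism = g-hom } , g-extends

  sendVertex : ∀ y z → Σ (BijectiveEndo G) λ g → to g y ≡ z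
  sendVertex y z =
    let g , g-extends = extend (y ∷ []) (λ _ → z) (λ { _ _ (here refl) (here refl) _ → refl })
                          (λ { _ _ (here refl) (here refl) y~y → contradiction y~y (∼-irr G) })
    in g , g-extends y (here refl)

  sendNonEdge : ∀ {x y p q} → x ≢ y → ¬ x ~ y → p ≢ q →
                Σ (BijectiveEndo G) λ g → to g x ≡ p × to g y ≡ q
  sendNonEdge {x} {y} {p} {q} x≢y x≁y p≢q =
    let g , g-extends = extend (x ∷ y ∷ []) f f-inj f-hom
    in g , trans (g-extends x (here refl)) fx , trans (g-extends y (there (here refl))) fy
    where
    f : ℕ → ℕ
    f z with z ≟ x
    ... | yes _ = p
    ... | no _ = q
    fx : f x ≡ p
    fx with x ≟ x
    ... | yes _ = refl
    ... | no x≢x = contradiction refl x≢x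
    fy : f y ≡ q
    fy with y ≟ x
    ... | yes y≡x = contradiction (sym y≡x) x≢y
    ... | no _ = refl
    f-inj : ∀ a b → a ∈ x ∷ y ∷ [] → b ∈ x ∷ y ∷ [] → f a ≡ f b → a ≡ b
    f-inj _ _ (here refl) (here refl) _ = refl
    f-inj _ _ (here refl) (there (here refl)) e = contradiction (trans (sym fx) (trans e fy)) p≢q
    f-inj _ _ (there (here refl)) (here refl) e = contradiction (trans (sym fx) (trans (sym e) fy)) p≢q
    f-inj _ _ (there (here refl)) (there (here refl)) _ = refl
    f-hom : ∀ a b → a ∈ x ∷ y ∷ [] → b ∈ x ∷ y ∷ [] → a ~ b → f a ~ f b
    f-hom _ _ (here refl) (here refl) x~x = contradiction x~x (∼-irr G)
    f-hom _ _ (here refl) (there (here refl)) x~y = contradiction x~y x≁y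
    f-hom _ _ (there (here refl)) (here refl) y~x = contradiction (∼-sym G y~x) x≁y
    f-hom _ _ (there (here refl)) (there (here refl)) y~y = contradiction y~y (∼-irr G)

  neighbours-distinctSequence : ∀ {a b x y} → a ~ b → x ≢ y → ¬ x ~ y → DistinctSequence (Neighbours G a)
  neighbours-distinctSequence {a} {b} {x} {y} a~b x≢y x≁y =
    let g , g-x , g-y = sendNonEdge x≢y x≁y (adjacent⇒≢ G a~b)
        k , k-a = sendVertex a x
    in orbit-distinctSequence {f = λ t → to g (to k t)}
         (λ e → injective k (injective g e))
         (λ a~t → Neighbours-map g g-x (Neighbours-map k k-a a~t))
         a~b
         (λ a~t gkt≡b → x≁y (subst (x ~_) (injective g (trans gkt≡b (sym g-y))) (Neighbours-map k k-a a~t)))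

  nonNeighbours-distinctSequence : ∀ {a b x y} → a ~ b → x ≢ y → ¬ x ~ y →
                                   DistinctSequence (NonNeighbours G x)
  nonNeighbours-distinctSequence {a} {b} {x} {y} a~b x≢y x≁y =
    let g , g-x , g-y = sendNonEdge x≢y x≁y (adjacent⇒≢ G a~b)
        k , k-a = sendVertex a x
    in orbit-distinctSequence {f = λ t → inverse g (inverse k t)}
         (λ e → inverse-injective k (inverse-injective g e))
         (λ x≁t → NonNeighbours-inverse g g-x (NonNeighbours-inverse k k-a x≁t))
         (≢-sym x≢y , x≁y)
         (λ x≁t g⁻¹k⁻¹t≡y → proj₂ (NonNeighbours-inverse k k-a x≁t)
           (subst (a ~_) (sym (trans (sym (to-inverse g _)) (trans (cong (to g) g⁻¹k⁻¹t≡y) g-y))) a~b))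

  neighbours-transfer : ∀ {a} → DistinctSequence (Neighbours G a) → ∀ v → DistinctSequence (Neighbours G v)
  neighbours-transfer {a} seq v =
    let m , m-a = sendVertex a v in distinctSequence-map (injective m) (Neighbours-map m m-a) seq

  nonNeighbours-transfer : ∀ {x} → DistinctSequence (NonNeighbours G x) →
                           ∀ v → DistinctSequence (NonNeighbours G v)
  nonNeighbours-transfer {x} seq v =
    let m , m-v = sendVertex v x in distinctSequence-map (inverse-injective m) (NonNeighbours-inverse m m-v) seq

module NonTrivialMBHomogeneous (em : ExcludedMiddle 0ℓ) {G : Graph ℕ} (mb : MBHomogeneous G)
         (¬complete : ¬ Complete G) (¬null : ¬ Null G) where

  open Rank em
  open MBHomogeneousGraph {G} mb

  private
    _~_ : ℕ → ℕ → Set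
    _~_ = _∼_ G

  edge : ∃₂ λ a b → a ~ b
  edge = em⇒dne em λ ¬edge → ¬null λ a b a~b → ¬edge (a , b , a~b)

  nonEdge : ∃₂ λ x y → x ≢ y × ¬ x ~ y
  nonEdge = em⇒dne em λ ¬nonEdge → ¬complete λ x y x≢y →
    em⇒dne em λ x≁y → ¬nonEdge (x , y , x≢y , x≁y)

  infinite-degree : ∀ v → Infinite (Neighbours G v)
  infinite-degree v =
    let _ , _ , a~b = edge
        _ , _ , x≢y , x≁y = nonEdge
    in distinctSequence⇒infinite (neighbours-transfer (neighbours-distinctSequence a~b x≢y x≁y) v)

  infinite-codegree : ∀ v → Infinite (NonNeighbours G v)
  infinite-codegree v =
    let _ , _ , a~b = edge
        _ , _ , x≢y , x≁y = nonEdge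
    in distinctSequence⇒infinite (nonNeighbours-transfer (nonNeighbours-distinctSequence a~b x≢y x≁y) v)

  module Disconnected (¬connected : ¬ Connected G) where

    outside : ∀ x → ∃ λ o → ¬ Reach G x o
    outside x = em⇒dne em λ ¬outside → ¬connected λ y z → em⇒dne em λ ¬y⇝z →
      ¬outside (y , λ x⇝y → ¬outside (z , λ x⇝z → ¬y⇝z (Reach-trans (Reach-sym x⇝y) x⇝z)))

    components-complete : ∀ {x y} → Reach G x y → x ≢ y → x ~ y
    components-complete {x} {y} x⇝y x≢y = em⇒dne em λ x≁y →
      let o , x⇝̸o = outside x
          g , g-x , g-y = sendNonEdge x≢y x≁y λ x≡o → x⇝̸o (subst (Reach G x) x≡o here)
      in x⇝̸o (subst₂ (Reach G) g-x g-y (Reach-map (homomorphism g) x⇝y))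

    components-infinite : ∀ x → Infinite (Reach G x)
    components-infinite x (l , cover) = infinite-degree x (l , λ t x~t → cover t (step x~t here))

    Reach⇒≐ : ∀ {x y} → Reach G x y → Reach G x ≐ Reach G y
    Reach⇒≐ x⇝y = (λ x⇝z → Reach-trans (Reach-sym x⇝y) x⇝z) , (λ y⇝z → Reach-trans x⇝y y⇝z)

    root : ℕ → ℕ
    root x = proj₁ (least {Reach G x} here)

    Reach-root : ∀ x → Reach G x (root x)
    Reach-root x = proj₁ (proj₂ (least {Reach G x} here))

    rank-root : ∀ x → rank (Reach G x) (root x) ≡ 0
    rank-root x = proj₂ (proj₂ (least {Reach G x} here))

    root-cong : ∀ {x y} → Reach G x y → root x ≡ root y
    root-cong {x} {y} x⇝y = rank-injective (Reach-root x) (Reach-trans x⇝y (Reach-root y))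
      (trans (rank-root x) (sym (trans (rank-cong (Reach⇒≐ x⇝y) (root y)) (rank-root y))))

    IsRoot : ℕ → Set
    IsRoot r = root r ≡ r

    root-IsRoot : ∀ x → IsRoot (root x)
    root-IsRoot x = sym (root-cong (Reach-root x))

    sameRoot⇒Reach : ∀ {x y} → root x ≡ root y → Reach G x y
    sameRoot⇒Reach {x} {y} e =
      Reach-trans (Reach-root x) (subst (λ r → Reach G r y) (sym e) (Reach-sym (Reach-root y)))

    roots-infinite : Infinite IsRoot
    roots-infinite (l , cover) =
      let o , 0⇝̸o = outside 0
          distinctSequence e e-injective 0⇝e = infinite⇒distinctSequence (components-infinite 0)
          g , g-extends = extend l e (λ _ _ _ _ → e-injective)
            (λ a b _ _ a~b → components-complete (Reach-trans (Reach-sym (0⇝e a)) (0⇝e b))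
                                                 (λ ea≡eb → adjacent⇒≢ G a~b (e-injective ea≡eb)))
          u = inverse g o
          g-root-u = g-extends (root u) (cover (root u) (root-IsRoot u))
      in 0⇝̸o (Reach-trans (0⇝e (root u))
                (subst₂ (Reach G) g-root-u (to-inverse g o) (Reach-map (homomorphism g) (Reach-sym (Reach-root u)))))

    componentIndex : ℕ → ℕ
    componentIndex x = rank IsRoot (root x)

    position : ℕ → ℕ
    position x = rank (Reach G x) x

    componentIndex⇒Reach : ∀ {x y} → componentIndex x ≡ componentIndex y → Reach G x y
    componentIndex⇒Reach {x} {y} e = sameRoot⇒Reach (rank-injective (root-IsRoot x) (root-IsRoot y) e)

    position-injective : ∀ {x y} → Reach G x y → position x ≡ position y → x ≡ y
    position-injective {x} {y} x⇝y e = rank-injective here x⇝y (trans e (rank-cong (Reach⇒≐ (Reach-sym x⇝y)) y))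

    ≅IωKω : G ≅ IωKω
    ≅IωKω = φ , (φ-injective , φ-surjective) , λ x y → φ-preserves , φ-reflects
      where
      φ : ℕ → ℕ × ℕ
      φ x = componentIndex x , position x

      φ-injective : Injective _≡_ _≡_ φ
      φ-injective e = position-injective (componentIndex⇒Reach (cong proj₁ e)) (cong proj₂ e)

      φ-surjective : Surjective _≡_ _≡_ φ
      φ-surjective (i , a) =
        let r , r-root , rank-r = rank-surjective {IsRoot} roots-infinite i
            x , r⇝x , rank-x = rank-surjective {Reach G r} (components-infinite r) a
            root-x = trans (sym (root-cong r⇝x)) r-root
        in x , λ { refl → cong₂ _,_ (trans (cong (rank IsRoot) root-x) rank-r)
                                     (trans (rank-cong (Reach⇒≐ (Reach-sym r⇝x)) x) rank-x) }

      φ-preserves : ∀ {x y} → x ~ y → _∼_ IωKω (φ x) (φ y)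
      φ-preserves x~y = cong (rank IsRoot) (root-cong (step x~y here)) ,
                        λ e → adjacent⇒≢ G x~y (position-injective (step x~y here) e)

      φ-reflects : ∀ {x y} → _∼_ IωKω (φ x) (φ y) → x ~ y
      φ-reflects (same-component , different-position) =
        components-complete (componentIndex⇒Reach same-component) λ { refl → different-position refl }

corollary24 : ExcludedMiddle 0ℓ → (G : Graph ℕ) → MBHomogeneous G →
    ¬ Complete G → ¬ Null G →
    (Connected G ⊎ (G ≅ IωKω)) ×
    (¬ Null G → ∀ v → Infinite (Neighbours G v) × Infinite (NonNeighbours G v))
corollary24 em G mb ¬complete ¬null = connected-or-IωKω , λ _ v → infinite-degree v , infinite-codegree v
  where
  open NonTrivialMBHomogeneous em mb ¬complete ¬null
  connected-or-IωKω : Connected G ⊎ (G ≅ IωKω)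
  connected-or-IωKω with em {Connected G}
  ... | yes connected = inj₁ connected
  ... | no ¬connected = inj₂ (Disconnected.≅IωKω ¬connected)
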